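{- Let $r\ge 2$ and let $\Gamma=\Gamma_1\cup\cdots\cup\Gamma_r$ be the disjoint union of graphs $\Gamma_1,\dots,\Gamma_r$ of orders $n_1,\dots,n_r$, and let $n=n_1+\cdots+n_r$. Then $$A(\Gamma;x)=x^{n-n_1}A(\Gamma_1;x)+\cdots+x^{n-n_r}A(\Gamma_r;x).$$
   Context: All graphs are finite and simple with at least one vertex. The disjoint union of graphs with disjoint vertex sets is the graph whose vertex and edge sets are the unions of theirs. For a graph $\Gamma=(V,E)$ of order $n$, a vertex $v$ and $X\subseteq V$, $\delta_X(v)$ is the number of neighbours of $v$ in $X$, $\delta_1$ the maximum degree, $\bar S=V\setminus S$, and $\mathcal{K}=[-\delta_1,\delta_1]\cap\mathbb{Z}$. A nonempty $S\subseteq V$ is a defensive $k$-alliance if $\delta_S(v)\ge\delta_{\bar S}(v)+k$ for all $v\in S$; its exact index of alliance is $k_S=\max\{k\in\mathcal{K}: S \text{ is a defensive } k\text{ -alliance}\}$. The alliance polynomial is $A(\Gamma;x)=\sum_{S} x^{n+k_S}$, the sum over all nonempty $S\subseteq V$ with induced subgraph $\langle S\rangle$ connected. -}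

module Defs where

open import Data.Bool using (Bool; true; false; _∧_; _∨_; not; if_then_else_)
open import Data.Nat as ℕ using (ℕ; zero; suc; _⊔_)
open import Data.Integer as ℤ using (ℤ; +_; -_; _-_)
open import Data.Fin using (Fin; zero; suc; splitAt)
open import Data.List using (List; []; _∷_; map; filter; length; foldr; _++_; allFin)
open import Data.Sum using (_⊎_; inj₁; inj₂)
open import Relation.Binary.PropositionalEquality using (_≡_; refl)
open import Relation.Nullary.Decidable using (⌊_⌋)
open import Data.Bool.Properties using (T?)

record Graph (n : ℕ) : Set where
  field
    adj    : Fin n → Fin n → Bool
    sym    : ∀ u v → adj u v ≡ adj v u
    irrefl : ∀ v → adj v v ≡ false
open Graph public

Subset : ℕ → Set
Subset n = Fin n → Bool

allSubsets : (n : ℕ) → List (Subset n)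
allSubsets zero = (λ ()) ∷ []
allSubsets (suc n) =
  map (λ S → λ { zero → false ; (suc i) → S i }) (allSubsets n) ++
  map (λ S → λ { zero → true  ; (suc i) → S i }) (allSubsets n)

count : {n : ℕ} → (Fin n → Bool) → ℕ
count {n} p = length (filter (λ i → T? (p i)) (allFin n))

anyF : {n : ℕ} → (Fin n → Bool) → Bool
anyF {n} p = foldr (λ i b → p i ∨ b) false (allFin n)

allF : {n : ℕ} → (Fin n → Bool) → Bool
allF {n} p = foldr (λ i b → p i ∧ b) true (allFin n)

complement : {n : ℕ} → Subset n → Subset n
complement S v = not (S v)

deg-in : {n : ℕ} → Graph n → Subset n → Fin n → ℕ
deg-in Γ X v = count (λ w → adj Γ v w ∧ X w)

degree : {n : ℕ} → Graph n → Fin n → ℕ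
degree Γ v = count (λ w → adj Γ v w)

maxDegree : {n : ℕ} → Graph n → ℕ
maxDegree {n} Γ = foldr (λ v m → degree Γ v ⊔ m) 0 (allFin n)

nonempty : {n : ℕ} → Subset n → Bool
nonempty S = anyF S

reach : {n : ℕ} → Graph n → Subset n → Fin n → ℕ → Subset n
reach Γ S u zero w = S u ∧ S w ∧ ⌊ u Data.Fin.≟ w ⌋
reach Γ S u (suc k) w =
  reach Γ S u k w ∨ (S w ∧ anyF (λ v → reach Γ S u k v ∧ adj Γ v w))

-- the induced subgraph ⟨S⟩ is connected: any two vertices of S are joined by a
-- walk inside S (of length ≤ n, which suffices in a graph of order n)
connected : {n : ℕ} → Graph n → Subset n → Bool
connected {n} Γ S = allF (λ u → allF (λ w → not (S u ∧ S w) ∨ reach Γ S u n w))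

isDefAlliance : {n : ℕ} → Graph n → Subset n → ℤ → Bool
isDefAlliance Γ S k =
  allF (λ v → not (S v) ∨
    ⌊ (+ deg-in Γ (complement S) v) ℤ.+ k ℤ.≤? (+ deg-in Γ S v) ⌋)

-- search downwards from k over t+1 values k, k-1, ..., k-t; the last value is
-- returned unconditionally (it is -δ₁, and every nonempty S is a defensive
-- (-δ₁)-alliance).
searchMax : {n : ℕ} → Graph n → Subset n → ℕ → ℤ → ℤ
searchMax Γ S zero k = k
searchMax Γ S (suc t) k =
  if isDefAlliance Γ S k then k else searchMax Γ S t (k - + 1)

-- exact index of alliance k_S = max { k ∈ [-δ₁, δ₁] : S is a defensive k-alliance }
exactIndex : {n : ℕ} → Graph n → Subset n → ℤ
exactIndex Γ S = searchMax Γ S (2 ℕ.* maxDegree Γ) (+ maxDegree Γ)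

-- The alliance polynomial A(Γ;x) = Σ_S x^{n + k_S} (S nonempty, ⟨S⟩ connected),
-- represented by its coefficient function: allianceCoeff Γ m is the
-- coefficient of x^m.
allianceCoeff : {n : ℕ} → Graph n → ℤ → ℕ
allianceCoeff {n} Γ m =
  length (filter (λ S → T? (nonempty S ∧ connected Γ S ∧
                             ⌊ (+ n) ℤ.+ exactIndex Γ S ℤ.≟ m ⌋))
                 (allSubsets n))

adjU : {m n : ℕ} → Graph m → Graph n → Fin (m ℕ.+ n) → Fin (m ℕ.+ n) → Bool
adjU {m} Γ₁ Γ₂ u v with splitAt m u | splitAt m v
... | inj₁ a | inj₁ b = adj Γ₁ a b
... | inj₂ a | inj₂ b = adj Γ₂ a b
... | inj₁ _ | inj₂ _ = false
... | inj₂ _ | inj₁ _ = false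

adjU-sym : {m n : ℕ} (Γ₁ : Graph m) (Γ₂ : Graph n) → ∀ u v → adjU Γ₁ Γ₂ u v ≡ adjU Γ₁ Γ₂ v u
adjU-sym {m} Γ₁ Γ₂ u v with splitAt m u | splitAt m v
... | inj₁ a | inj₁ b = sym Γ₁ a b
... | inj₂ a | inj₂ b = sym Γ₂ a b
... | inj₁ _ | inj₂ _ = refl
... | inj₂ _ | inj₁ _ = refl

adjU-irrefl : {m n : ℕ} (Γ₁ : Graph m) (Γ₂ : Graph n) → ∀ v → adjU Γ₁ Γ₂ v v ≡ false
adjU-irrefl {m} Γ₁ Γ₂ v with splitAt m v
... | inj₁ a = irrefl Γ₁ a
... | inj₂ a = irrefl Γ₂ a

_⊕_ : {m n : ℕ} → Graph m → Graph n → Graph (m ℕ.+ n)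
Γ₁ ⊕ Γ₂ = record { adj = adjU Γ₁ Γ₂ ; sym = adjU-sym Γ₁ Γ₂ ; irrefl = adjU-irrefl Γ₁ Γ₂ }

emptyGraph : Graph 0
emptyGraph = record { adj = λ () ; sym = λ () ; irrefl = λ () }

sumF : (r : ℕ) → (Fin r → ℕ) → ℕ
sumF zero f = 0
sumF (suc r) f = f zero ℕ.+ sumF r (λ i → f (suc i))

unionF : (r : ℕ) (ns : Fin r → ℕ) → ((i : Fin r) → Graph (ns i)) → Graph (sumF r ns)
unionF zero ns Γs = emptyGraph
unionF (suc r) ns Γs = Γs zero ⊕ unionF r (λ i → ns (suc i)) (λ i → Γs (suc i))

module Submission where

-- By induction on r it suffices to treat Γ₁ ⊕ Γ₂ of orders a and b and show
--   coeff(Γ₁ ⊕ Γ₂, m) = coeff(Γ₁, m − b) + coeff(Γ₂, m − a).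
-- A vertex set S of Γ₁ ⊕ Γ₂ is a pair (A, B) of vertex sets of the two parts.
-- If both are nonempty, ⟨S⟩ is disconnected since no walk crosses between the
-- parts.  If B = ∅, then degrees of vertices of A are the same in Γ₁ and in the
-- union, so ⟨S⟩ is connected iff ⟨A⟩ is, and k_S = k_A; the order grows by b,
-- so S contributes x^b times the monomial of A.  Symmetrically if A = ∅.
--
-- The definitions are computational, which adds two points: connectivity is
-- tested with walks of length the order, so we show that reachability sets
-- stabilise by then; and k_S is a downward search from the maximum degree δ₁,
-- so we show that any search starting at D ≥ δ₁ finds k_S, since every set is
-- a (−δ₁)-alliance and no nonempty set is a K-alliance for K > δ₁.

open import Algebra.Structures using (IsMonoid; IsCommutativeMonoid)
open import Data.Bool using (Bool; true; false; _∧_; _∨_; not; if_then_else_)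
open import Data.Bool.Properties
  using (T?; ∨-isMonoid; ∧-isMonoid; ∨-isCommutativeMonoid; ∧-isCommutativeMonoid;
         ∧-conicalˡ; ∨-zeroʳ; ∧-zeroʳ)
open import Data.Fin using (Fin; zero; suc; _↑ˡ_; _↑ʳ_; splitAt) renaming (_≟_ to _≟ᶠ_)
open import Data.Fin.Properties using (splitAt-↑ˡ; splitAt-↑ʳ; ↑ˡ-injective; ↑ʳ-injective)
open import Data.Integer as ℤ using (ℤ; +_; -_; _-_)
import Data.Integer.Properties as ℤ
import Data.Integer.Tactic.RingSolver as ℤ-Solver
open import Data.List using (List; []; _∷_; filter; length; foldr; tabulate; allFin; map; _++_)
open import Data.List.Properties using (foldr-map; map-++; map-∘; map-cong)
open import Data.Nat using (ℕ; zero; suc; _+_; _*_; _∸_; _⊔_; _≤_; _<_; z≤n; s≤s)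
open import Data.Nat.ListAction using (sum)
open import Data.Nat.ListAction.Properties using (sum-++)
open import Data.Nat.Properties
import Data.Nat.Tactic.RingSolver as ℕ-Solver
open import Algebra.Properties.CommutativeSemigroup +-commutativeSemigroup using (interchange)
open import Data.Product using (∃; _,_; _×_)
open import Data.Sum using (_⊎_; inj₁; inj₂; [_,_]′)
open import Function using (_∘_; id)
open import Function.Bundles using (mk⇔)
open import Relation.Binary.PropositionalEquality
open import Relation.Nullary using (Dec; ¬_; contradiction)
open import Relation.Nullary.Decidable using (⌊_⌋; isYes≗does; dec-true; dec-false; does-⇔)
open import Defs hiding (sym)

ind : Bool → ℕ
ind true  = 1
ind false = 0

-- ⨁ f = f 0 ⊙ (f 1 ⊙ (⋯ ⊙ ε)): the iterated operation over Fin n.  The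
-- quantifiers anyF, allF, count and maxDegree of Defs are all of this form.
module _ {A : Set} (_⊙_ : A → A → A) (ε : A) where

  ⨁ : ∀ {n} → (Fin n → A) → A
  ⨁ {zero}  f = ε
  ⨁ {suc n} f = f zero ⊙ ⨁ (f ∘ suc)

  ⨁-cong : ∀ {n} {f g : Fin n → A} → f ≗ g → ⨁ f ≡ ⨁ g
  ⨁-cong {zero}  f≗g = refl
  ⨁-cong {suc n} f≗g = cong₂ _⊙_ (f≗g zero) (⨁-cong (f≗g ∘ suc))

  foldr-allFin : ∀ {n} (f : Fin n → A) → foldr (λ i acc → f i ⊙ acc) ε (allFin n) ≡ ⨁ f
  foldr-allFin f = foldr-tabulate f id
    where
    foldr-tabulate : ∀ {n N} (f : Fin N → A) (h : Fin n → Fin N) →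
      foldr (λ i acc → f i ⊙ acc) ε (tabulate h) ≡ ⨁ (f ∘ h)
    foldr-tabulate {zero}  f h = refl
    foldr-tabulate {suc n} f h = cong (f (h zero) ⊙_) (foldr-tabulate f (h ∘ suc))

module ⨁-Laws {A : Set} {_⊙_ : A → A → A} {ε : A} (M : IsMonoid _≡_ _⊙_ ε) where
  open IsMonoid M using (assoc; identityˡ)

  ⨁-ε : ∀ {n} (f : Fin n → A) → (∀ i → f i ≡ ε) → ⨁ _⊙_ ε f ≡ ε
  ⨁-ε {zero}  f f≡ε = refl
  ⨁-ε {suc n} f f≡ε = begin
    f zero ⊙ ⨁ _⊙_ ε (f ∘ suc) ≡⟨ cong₂ _⊙_ (f≡ε zero) (⨁-ε (f ∘ suc) (f≡ε ∘ suc)) ⟩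
    ε ⊙ ε                      ≡⟨ identityˡ ε ⟩
    ε                          ∎
    where open ≡-Reasoning

  ⨁-↑ : ∀ a {b} (f : Fin (a + b) → A) →
        ⨁ _⊙_ ε f ≡ ⨁ _⊙_ ε (f ∘ (_↑ˡ b)) ⊙ ⨁ _⊙_ ε (f ∘ (a ↑ʳ_))
  ⨁-↑ zero    f = sym (identityˡ _)
  ⨁-↑ (suc a) f = trans (cong (f zero ⊙_) (⨁-↑ a (f ∘ suc))) (sym (assoc _ _ _))

anyᶠ allᶠ : ∀ {n} → (Fin n → Bool) → Bool
anyᶠ = ⨁ _∨_ false
allᶠ = ⨁ _∧_ true

countᶠ : ∀ {n} → (Fin n → Bool) → ℕ
countᶠ p = ⨁ _+_ 0 (ind ∘ p)

maxᶠ : ∀ {n} → (Fin n → ℕ) → ℕ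
maxᶠ = ⨁ _⊔_ 0

anyF≡anyᶠ : ∀ {n} (p : Fin n → Bool) → anyF p ≡ anyᶠ p
anyF≡anyᶠ = foldr-allFin _∨_ false

allF≡allᶠ : ∀ {n} (p : Fin n → Bool) → allF p ≡ allᶠ p
allF≡allᶠ = foldr-allFin _∧_ true

length-filter : ∀ {A : Set} (p : A → Bool) (xs : List A) →
  length (filter (λ x → T? (p x)) xs) ≡ sum (map (ind ∘ p) xs)
length-filter p []       = refl
length-filter p (x ∷ xs) with p x
... | true  = cong suc (length-filter p xs)
... | false = length-filter p xs

count≡countᶠ : ∀ {n} (p : Fin n → Bool) → count p ≡ countᶠ p
count≡countᶠ {n} p = begin
  count p                                       ≡⟨ length-filter p (allFin n) ⟩
  sum (map (ind ∘ p) (allFin n))                ≡⟨ foldr-map _+_ (ind ∘ p) 0 (allFin n) ⟩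
  foldr (λ i c → ind (p i) + c) 0 (allFin n)    ≡⟨ foldr-allFin _+_ 0 (ind ∘ p) ⟩
  countᶠ p                                      ∎
  where open ≡-Reasoning

maxDegree≡maxᶠ : ∀ {n} (Γ : Graph n) → maxDegree Γ ≡ maxᶠ (degree Γ)
maxDegree≡maxᶠ Γ = foldr-allFin _⊔_ 0 (degree Γ)

anyF-cong : ∀ {n} {p q : Fin n → Bool} → p ≗ q → anyF p ≡ anyF q
anyF-cong {p = p} {q} p≗q = trans (anyF≡anyᶠ p) (trans (⨁-cong _∨_ false p≗q) (sym (anyF≡anyᶠ q)))

allF-cong : ∀ {n} {p q : Fin n → Bool} → p ≗ q → allF p ≡ allF q
allF-cong {p = p} {q} p≗q = trans (allF≡allᶠ p) (trans (⨁-cong _∧_ true p≗q) (sym (allF≡allᶠ q)))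

count-cong : ∀ {n} {p q : Fin n → Bool} → p ≗ q → count p ≡ count q
count-cong {p = p} {q} p≗q =
  trans (count≡countᶠ p) (trans (⨁-cong _+_ 0 (cong ind ∘ p≗q)) (sym (count≡countᶠ q)))

anyᶠ-witness : ∀ {n} (p : Fin n → Bool) → anyᶠ p ≡ true → ∃ λ i → p i ≡ true
anyᶠ-witness {suc n} p h with p zero in e
... | true  = zero , e
... | false with anyᶠ-witness (p ∘ suc) h
...   | i , pi = suc i , pi

anyᶠ-false : ∀ {n} (p : Fin n → Bool) → anyᶠ p ≡ false → ∀ i → p i ≡ false
anyᶠ-false {suc n} p h i with p zero in e
anyᶠ-false {suc n} p () i       | true
anyᶠ-false {suc n} p h zero     | false = e
anyᶠ-false {suc n} p h (suc i)  | false = anyᶠ-false (p ∘ suc) h i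

allᶠ-false : ∀ {n} (p : Fin n → Bool) (i : Fin n) → p i ≡ false → allᶠ p ≡ false
allᶠ-false {suc n} p zero    e = cong (_∧ allᶠ (p ∘ suc)) e
allᶠ-false {suc n} p (suc i) e with p zero
... | true  = allᶠ-false (p ∘ suc) i e
... | false = refl

allF-true : ∀ {n} (p : Fin n → Bool) → (∀ i → p i ≡ true) → allF p ≡ true
allF-true p holds = trans (allF≡allᶠ p) (⨁-Laws.⨁-ε ∧-isMonoid p holds)

anyF-false : ∀ {n} (p : Fin n → Bool) → (∀ i → p i ≡ false) → anyF p ≡ false
anyF-false p fails = trans (anyF≡anyᶠ p) (⨁-Laws.⨁-ε ∨-isMonoid p fails)

_⊆_ : ∀ {n} → (Fin n → Bool) → (Fin n → Bool) → Set
p ⊆ q = ∀ i → p i ≡ true → q i ≡ true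

count-bound : ∀ {n} (p : Fin n → Bool) → countᶠ p ≤ n
count-bound {zero}  p = z≤n
count-bound {suc n} p with p zero
... | true  = s≤s (count-bound (p ∘ suc))
... | false = m≤n⇒m≤1+n (count-bound (p ∘ suc))

count-grows : ∀ {n} (p q : Fin n → Bool) → p ⊆ q → q ≗ p ⊎ countᶠ p < countᶠ q
count-grows {zero}  p q p⊆q = inj₁ (λ ())
count-grows {suc n} p q p⊆q
  with p zero in ep | q zero in eq | count-grows (p ∘ suc) (q ∘ suc) (p⊆q ∘ suc)
... | true  | false | _ = contradiction (trans (sym (p⊆q zero ep)) eq) λ ()
... | true  | true  | inj₁ same = inj₁ λ { zero → trans eq (sym ep) ; (suc i) → same i }
... | true  | true  | inj₂ grow = inj₂ (s≤s grow)
... | false | false | inj₁ same = inj₁ λ { zero → trans eq (sym ep) ; (suc i) → same i }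
... | false | false | inj₂ grow = inj₂ grow
... | false | true  | inj₁ same = inj₂ (s≤s (≤-reflexive (⨁-cong _+_ 0 (cong ind ∘ sym ∘ same))))
... | false | true  | inj₂ grow = inj₂ (s≤s (<⇒≤ grow))

count-mono : ∀ {n} (p q : Fin n → Bool) → p ⊆ q → countᶠ p ≤ countᶠ q
count-mono p q p⊆q with count-grows p q p⊆q
... | inj₁ same = ≤-reflexive (⨁-cong _+_ 0 (cong ind ∘ sym ∘ same))
... | inj₂ grow = <⇒≤ grow

maxᶠ-upper : ∀ {n} (f : Fin n → ℕ) (i : Fin n) → f i ≤ maxᶠ f
maxᶠ-upper f zero    = m≤m⊔n _ _
maxᶠ-upper f (suc i) = ≤-trans (maxᶠ-upper (f ∘ suc) i) (m≤n⊔m _ _)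

maxᶠ-least : ∀ {n} (f : Fin n → ℕ) {M : ℕ} → (∀ i → f i ≤ M) → maxᶠ f ≤ M
maxᶠ-least {zero}  f f≤M = z≤n
maxᶠ-least {suc n} f f≤M = ⊔-lub (f≤M zero) (maxᶠ-least (f ∘ suc) (f≤M ∘ suc))

_◃_ : ∀ {n} → Bool → Subset n → Subset (suc n)
(b ◃ S) zero    = b
(b ◃ S) (suc i) = S i

Σˢ : (n : ℕ) → (Subset n → ℕ) → ℕ
Σˢ zero    f = f (λ ())
Σˢ (suc n) f = Σˢ n (f ∘ (false ◃_)) + Σˢ n (f ∘ (true ◃_))

Extensional : ∀ {n} {B : Set} → (Subset n → B) → Set
Extensional {n} f = ∀ {S T : Subset n} → S ≗ T → f S ≡ f T

◃-cong : ∀ {n} (b : Bool) {S T : Subset n} → S ≗ T → (b ◃ S) ≗ (b ◃ T)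
◃-cong b S≗T zero    = refl
◃-cong b S≗T (suc i) = S≗T i

Σˢ-cong : ∀ n {f g : Subset n → ℕ} → (∀ S → f S ≡ g S) → Σˢ n f ≡ Σˢ n g
Σˢ-cong zero    f≡g = f≡g _
Σˢ-cong (suc n) f≡g = cong₂ _+_ (Σˢ-cong n (f≡g ∘ (false ◃_))) (Σˢ-cong n (f≡g ∘ (true ◃_)))

Σˢ-+ : ∀ n (f g : Subset n → ℕ) → Σˢ n (λ S → f S + g S) ≡ Σˢ n f + Σˢ n g
Σˢ-+ zero    f g = refl
Σˢ-+ (suc n) f g = trans
  (cong₂ _+_ (Σˢ-+ n (f ∘ (false ◃_)) (g ∘ (false ◃_))) (Σˢ-+ n (f ∘ (true ◃_)) (g ∘ (true ◃_))))
  (interchange (Σˢ n (f ∘ (false ◃_))) _ _ _)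

Σˢ-0 : ∀ n → Σˢ n (λ _ → 0) ≡ 0
Σˢ-0 zero    = refl
Σˢ-0 (suc n) = cong₂ _+_ (Σˢ-0 n) (Σˢ-0 n)

-- The empty set is the only subset on which anyᶠ fails.
Σˢ-empty : ∀ n (K : ℕ) → Σˢ n (λ S → if anyᶠ S then 0 else K) ≡ K
Σˢ-empty zero    K = refl
Σˢ-empty (suc n) K = trans (cong₂ _+_ (Σˢ-empty n K) (Σˢ-0 n)) (+-identityʳ K)

Σˢ-if : ∀ n (α : Bool) (f : Subset n → ℕ) →
        Σˢ n (λ S → if α then 0 else f S) ≡ (if α then 0 else Σˢ n f)
Σˢ-if n true  f = Σˢ-0 n
Σˢ-if n false f = refl

filter-allSubsets : ∀ n (P : Subset n → Bool) → Extensional P →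
  length (filter (λ S → T? (P S)) (allSubsets n)) ≡ Σˢ n (ind ∘ P)
filter-allSubsets n P P-ext =
  trans (length-filter P (allSubsets n)) (sum-allSubsets n (ind ∘ P) (cong ind ∘ P-ext))
  where
  sum-allSubsets : ∀ n (f : Subset n → ℕ) → Extensional f → sum (map f (allSubsets n)) ≡ Σˢ n f
  sum-allSubsets zero    f f-ext = +-identityʳ _
  sum-allSubsets (suc n) f f-ext = begin
    sum (map f (map _ xs ++ map _ xs))           ≡⟨ cong sum (map-++ f (map _ xs) _) ⟩
    sum (map f (map _ xs) ++ map f (map _ xs))   ≡⟨ sum-++ (map f (map _ xs)) _ ⟩
    sum (map f (map _ xs)) + sum (map f (map _ xs))
      ≡⟨ cong₂ _+_ (half false _ (λ S → λ { zero → refl ; (suc i) → refl }))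
                   (half true  _ (λ S → λ { zero → refl ; (suc i) → refl })) ⟩
    Σˢ (suc n) f                                 ∎
    where
    open ≡-Reasoning
    xs = allSubsets n
    half : ∀ b (g : Subset n → Subset (suc n)) → (∀ S → g S ≗ (b ◃ S)) →
           sum (map f (map g xs)) ≡ Σˢ n (f ∘ (b ◃_))
    half b g g≗ = begin
      sum (map f (map g xs))     ≡⟨ cong sum (sym (map-∘ xs)) ⟩
      sum (map (f ∘ g) xs)       ≡⟨ cong sum (map-cong (λ S → f-ext (g≗ S)) xs) ⟩
      sum (map (f ∘ (b ◃_)) xs)  ≡⟨ sum-allSubsets n (f ∘ (b ◃_)) (f-ext ∘ ◃-cong b) ⟩
      Σˢ n (f ∘ (b ◃_))          ∎

joinˢ : ∀ {a b} → Subset a → Subset b → Subset (a + b)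
joinˢ {a} A B i = [ A , B ]′ (splitAt a i)

joinˢ-↑ˡ : ∀ {a b} (A : Subset a) (B : Subset b) x → joinˢ A B (x ↑ˡ b) ≡ A x
joinˢ-↑ˡ {a} {b} A B x rewrite splitAt-↑ˡ a x b = refl

joinˢ-↑ʳ : ∀ {a b} (A : Subset a) (B : Subset b) y → joinˢ A B (a ↑ʳ y) ≡ B y
joinˢ-↑ʳ {a} {b} A B y rewrite splitAt-↑ʳ a b y = refl

Σˢ-join : ∀ a {b} (f : Subset (a + b) → ℕ) → Extensional f →
          Σˢ (a + b) f ≡ Σˢ a (λ A → Σˢ b (λ B → f (joinˢ A B)))
Σˢ-join zero        f f-ext = refl
Σˢ-join (suc a) {b} f f-ext = cong₂ _+_ (half false) (half true)
  where
  ◃-joinˢ : ∀ x (A : Subset a) (B : Subset b) → (x ◃ joinˢ A B) ≗ joinˢ (x ◃ A) B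
  ◃-joinˢ x A B zero = refl
  ◃-joinˢ x A B (suc i) with splitAt a i
  ... | inj₁ _ = refl
  ... | inj₂ _ = refl
  half : ∀ x → Σˢ (a + b) (f ∘ (x ◃_)) ≡ Σˢ a (λ A → Σˢ b (λ B → f (joinˢ (x ◃ A) B)))
  half x = trans (Σˢ-join a (f ∘ (x ◃_)) (f-ext ∘ ◃-cong x))
                 (Σˢ-cong a λ A → Σˢ-cong b λ B → f-ext (◃-joinˢ x A B))

-- An increasing sequence R of subsets of Fin n in which each term is a fixed
-- function F of the previous one is constant from step n on: it can grow at most
-- n times, and once two consecutive terms agree all later ones do.
module Stabilisation {n} (F : Subset n → Subset n) (F-cong : ∀ {X Y} → X ≗ Y → F X ≗ F Y)
                     (R : ℕ → Subset n) (R-suc : ∀ k → R (suc k) ≗ F (R k))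
                     (R-incr : ∀ k → R k ⊆ R (suc k)) where

  Stable : ℕ → Set
  Stable k = R (suc k) ≗ R k

  stable-forever : ∀ {k} → Stable k → ∀ j → R (j + k) ≗ R k
  stable-forever     st zero    w = refl
  stable-forever {k} st (suc j) w = begin
    R (suc (j + k)) w  ≡⟨ R-suc (j + k) w ⟩
    F (R (j + k)) w    ≡⟨ F-cong (stable-forever st j) w ⟩
    F (R k) w          ≡⟨ sym (R-suc k w) ⟩
    R (suc k) w        ≡⟨ st w ⟩
    R k w              ∎
    where open ≡-Reasoning

  progress : ∀ k → (∃ λ j → j < k × Stable j) ⊎ k ≤ countᶠ (R k)
  progress zero = inj₂ z≤n
  progress (suc k) with progress k
  ... | inj₁ (j , j<k , st) = inj₁ (j , m<n⇒m<1+n j<k , st)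
  ... | inj₂ k≤count with count-grows (R k) (R (suc k)) (R-incr k)
  ...   | inj₁ st   = inj₁ (k , n<1+n k , st)
  ...   | inj₂ grow = inj₂ (≤-trans (s≤s k≤count) grow)

  stabilises : ∀ j → R (j + n) ≗ R n
  stabilises j w with progress (suc n)
  ... | inj₂ n<count = contradiction (count-bound (R (suc n))) (<⇒≱ n<count)
  ... | inj₁ (i , s≤s i≤n , st) = begin
    R (j + n) w        ≡⟨ cong (λ k → R k w) j+n≡ ⟩
    R ((j + d) + i) w  ≡⟨ stable-forever st (j + d) w ⟩
    R i w              ≡⟨ sym (stable-forever st d w) ⟩
    R (d + i) w        ≡⟨ cong (λ k → R k w) (m∸n+n≡m i≤n) ⟩
    R n w              ∎
    where
    open ≡-Reasoning
    d = n ∸ i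
    j+n≡ : j + n ≡ (j + d) + i
    j+n≡ = trans (cong (_+_ j) (sym (m∸n+n≡m i≤n))) (sym (+-assoc j d i))

reach-stabilises : ∀ {n} (Γ : Graph n) (S : Subset n) (u : Fin n) j →
                   reach Γ S u (j + n) ≗ reach Γ S u n
reach-stabilises Γ S u = Stabilisation.stabilises step step-cong (reach Γ S u) (λ k w → refl) incr
  where
  step : Subset _ → Subset _
  step X w = X w ∨ (S w ∧ anyF (λ v → X v ∧ adj Γ v w))
  step-cong : ∀ {X Y} → X ≗ Y → step X ≗ step Y
  step-cong X≗Y w = cong₂ _∨_ (X≗Y w) (cong (S w ∧_) (anyF-cong λ v → cong (_∧ adj Γ v w) (X≗Y v)))
  incr : ∀ k → reach Γ S u k ⊆ reach Γ S u (suc k)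
  incr k w reached = cong (_∨ (S w ∧ anyF (λ v → reach Γ S u k v ∧ adj Γ v w))) reached

-- One step of the downward search, seen from above and from below.
one-down : ∀ (k x : ℤ) → k ℤ.+ (+ 1 ℤ.+ x) - + 1 ≡ k ℤ.+ x
one-down = ℤ-Solver.solve-∀

one-more : ∀ (k x : ℤ) → k - + 1 - x ≡ k - (+ 1 ℤ.+ x)
one-more = ℤ-Solver.solve-∀

searchDown : (ℤ → Bool) → ℕ → ℤ → ℤ
searchDown f zero    k = k
searchDown f (suc t) k = if f k then k else searchDown f t (k - + 1)

searchDown-cong : ∀ {f g : ℤ → Bool} → f ≗ g → ∀ t k → searchDown f t k ≡ searchDown g t k
searchDown-cong f≗g zero    k = refl
searchDown-cong {g = g} f≗g (suc t) k rewrite f≗g k =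
  cong (if g k then k else_) (searchDown-cong f≗g t (k - + 1))

searchMax≡searchDown : ∀ {n} (Γ : Graph n) (S : Subset n) t k →
                       searchMax Γ S t k ≡ searchDown (isDefAlliance Γ S) t k
searchMax≡searchDown Γ S zero    k = refl
searchMax≡searchDown Γ S (suc t) k =
  cong (if isDefAlliance Γ S k then k else_) (searchMax≡searchDown Γ S t (k - + 1))

searchDown-skip : ∀ f s t k → (∀ j → j < s → f (k ℤ.+ + suc j) ≡ false) →
                  searchDown f (s + t) (k ℤ.+ + s) ≡ searchDown f t k
searchDown-skip f zero    t k fails = cong (searchDown f t) (ℤ.+-identityʳ k)
searchDown-skip f (suc s) t k fails rewrite fails s ≤-refl | one-down k (+ s) =
  searchDown-skip f s t k (λ j j<s → fails j (m<n⇒m<1+n j<s))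

searchDown-extend : ∀ f t t′ k → t ≤ t′ → f (k - + t) ≡ true →
                    searchDown f t k ≡ searchDown f t′ k
searchDown-extend f zero zero     k _ _ = refl
searchDown-extend f zero (suc t′) k _ holds rewrite ℤ.+-identityʳ k | holds = refl
searchDown-extend f (suc t) (suc t′) k (s≤s t≤t′) holds with f k
... | true  = refl
... | false = searchDown-extend f t t′ (k - + 1) t≤t′ (trans (cong f (one-more k (+ t))) holds)

searchDown-window : ∀ f d D → d ≤ D → (∀ K → d < K → f (+ K) ≡ false) → f (- + d) ≡ true →
                    searchDown f (2 * D) (+ D) ≡ searchDown f (2 * d) (+ d)
searchDown-window f d D d≤D fails holds = begin
  searchDown f (2 * D) (+ D)                ≡⟨ cong₂ (searchDown f) 2D≡ (cong +_ D≡) ⟩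
  searchDown f (e + (2 * d + e)) (+ (d + e)) ≡⟨ searchDown-skip f e (2 * d + e) (+ d) above-d ⟩
  searchDown f (2 * d + e) (+ d)            ≡⟨ sym (searchDown-extend f (2 * d) (2 * d + e) (+ d)
                                                      (m≤m+n (2 * d) e) (trans (cong f bottom) holds)) ⟩
  searchDown f (2 * d) (+ d)                ∎
  where
  open ≡-Reasoning
  e = D ∸ d
  D≡ : D ≡ d + e
  D≡ = sym (m+[n∸m]≡n d≤D)
  double : ∀ d e → 2 * (d + e) ≡ e + (2 * d + e)
  double = ℕ-Solver.solve-∀
  2D≡ : 2 * D ≡ e + (2 * d + e)
  2D≡ = trans (cong (2 *_) D≡) (double d e)
  above-d : ∀ j → j < e → f (+ (d + suc j)) ≡ false
  above-d j _ = fails (d + suc j) (m<m+n d (s≤s z≤n))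
  negate : ∀ (x : ℤ) → x - (x ℤ.+ x) ≡ - x
  negate = ℤ-Solver.solve-∀
  bottom : + d - + (2 * d) ≡ - + d
  bottom = trans (cong (λ t → + d - + t) (cong (_+_ d) (+-identityʳ d))) (negate (+ d))

⌊⌋-true : ∀ {A : Set} (a? : Dec A) → A → ⌊ a? ⌋ ≡ true
⌊⌋-true a? a = trans (isYes≗does a?) (dec-true a? a)

⌊⌋-false : ∀ {A : Set} (a? : Dec A) → ¬ A → ⌊ a? ⌋ ≡ false
⌊⌋-false a? ¬a = trans (isYes≗does a?) (dec-false a? ¬a)

⌊⌋-⇔ : ∀ {A B : Set} → (A → B) → (B → A) → (a? : Dec A) (b? : Dec B) → ⌊ a? ⌋ ≡ ⌊ b? ⌋
⌊⌋-⇔ to from a? b? = trans (isYes≗does a?) (trans (does-⇔ (mk⇔ to from) a? b?) (sym (isYes≗does b?)))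

allianceTest : ∀ {n} → Graph n → Subset n → ℤ → Fin n → Bool
allianceTest Γ S k v = not (S v) ∨ ⌊ (+ deg-in Γ (complement S) v) ℤ.+ k ℤ.≤? (+ deg-in Γ S v) ⌋

-- The range of the exact index: every set is a defensive (−δ₁)-alliance, and no
-- nonempty set is a defensive K-alliance for K > δ₁.  Hence k_S is found by any
-- downward search of the alliance test from D ≥ δ₁ through 2D + 1 values.
module AllianceRange {n} (Γ : Graph n) where

  Δ : ℕ
  Δ = maxDegree Γ

  deg-in≤Δ : ∀ X v → deg-in Γ X v ≤ Δ
  deg-in≤Δ X v = begin
    deg-in Γ X v                    ≡⟨ count≡countᶠ (λ w → adj Γ v w ∧ X w) ⟩
    countᶠ (λ w → adj Γ v w ∧ X w)  ≤⟨ count-mono _ (adj Γ v) (λ w → ∧-conicalˡ _ _) ⟩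
    countᶠ (adj Γ v)                ≡⟨ sym (count≡countᶠ (adj Γ v)) ⟩
    degree Γ v                      ≤⟨ maxᶠ-upper (degree Γ) v ⟩
    maxᶠ (degree Γ)                 ≡⟨ sym (maxDegree≡maxᶠ Γ) ⟩
    Δ                               ∎
    where open ≤-Reasoning

  alliance-at-−Δ : ∀ S → isDefAlliance Γ S (- + Δ) ≡ true
  alliance-at-−Δ S = allF-true (allianceTest Γ S (- + Δ)) λ v →
    trans (cong (not (S v) ∨_) (⌊⌋-true (test v) (bound v))) (∨-zeroʳ _)
    where
    test : ∀ v → Dec (+ deg-in Γ (complement S) v ℤ.+ - + Δ ℤ.≤ + deg-in Γ S v)
    test v = + deg-in Γ (complement S) v ℤ.+ - + Δ ℤ.≤? + deg-in Γ S v
    bound : ∀ v → + deg-in Γ (complement S) v - + Δ ℤ.≤ + deg-in Γ S v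
    bound v = ℤ.≤-trans (ℤ.i≤j⇒i-j≤0 (ℤ.+≤+ (deg-in≤Δ (complement S) v))) (ℤ.+≤+ z≤n)

  no-alliance-above-Δ : ∀ S → anyF S ≡ true → ∀ K → Δ < K → isDefAlliance Γ S (+ K) ≡ false
  no-alliance-above-Δ S nonempty K Δ<K with anyᶠ-witness S (trans (sym (anyF≡anyᶠ S)) nonempty)
  ... | v , v∈S = trans (allF≡allᶠ (allianceTest Γ S (+ K))) (allᶠ-false (allianceTest Γ S (+ K)) v
                    (trans (cong (λ b → not b ∨ ⌊ test ⌋) v∈S) (⌊⌋-false test too-large)))
    where
    test : Dec (+ deg-in Γ (complement S) v ℤ.+ + K ℤ.≤ + deg-in Γ S v)
    test = + deg-in Γ (complement S) v ℤ.+ + K ℤ.≤? + deg-in Γ S v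
    too-large : ¬ (+ deg-in Γ (complement S) v ℤ.+ + K ℤ.≤ + deg-in Γ S v)
    too-large le = <⇒≱ Δ<K (≤-trans (m≤n+m K _) (≤-trans (ℤ.drop‿+≤+ le) (deg-in≤Δ S v)))

  exactIndex-search : ∀ S → anyF S ≡ true → (f : ℤ → Bool) → f ≗ isDefAlliance Γ S →
                      ∀ D → Δ ≤ D → searchDown f (2 * D) (+ D) ≡ exactIndex Γ S
  exactIndex-search S nonempty f f≗ D Δ≤D = begin
    searchDown f (2 * D) (+ D)                         ≡⟨ searchDown-cong f≗ (2 * D) (+ D) ⟩
    searchDown (isDefAlliance Γ S) (2 * D) (+ D)       ≡⟨ searchDown-window _ Δ D Δ≤D
                                                            (no-alliance-above-Δ S nonempty)
                                                            (alliance-at-−Δ S) ⟩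
    searchDown (isDefAlliance Γ S) (2 * Δ) (+ Δ)       ≡⟨ sym (searchMax≡searchDown Γ S (2 * Δ) (+ Δ)) ⟩
    exactIndex Γ S                                     ∎
    where open ≡-Reasoning

∧-congʳ-when : ∀ {a b c d : Bool} → a ≡ b → (b ≡ true → c ≡ d) → a ∧ c ≡ b ∧ d
∧-congʳ-when {b = true}  refl c≡d = c≡d refl
∧-congʳ-when {b = false} refl _   = refl

⌊⌋-shift : ∀ {X Y c : ℤ} m → X ≡ Y ℤ.+ c → ⌊ X ℤ.≟ m ⌋ ≡ ⌊ Y ℤ.≟ m - c ⌋
⌊⌋-shift {X} {Y} {c} m X≡Y+c = ⌊⌋-⇔ to from (X ℤ.≟ m) (Y ℤ.≟ m - c)
  where
  cancel : ∀ (i j : ℤ) → i ℤ.+ j - j ≡ i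
  cancel = ℤ-Solver.solve-∀
  uncancel : ∀ (i j : ℤ) → i - j ℤ.+ j ≡ i
  uncancel = ℤ-Solver.solve-∀
  to : X ≡ m → Y ≡ m - c
  to X≡m = trans (sym (cancel Y c)) (cong (_- c) (trans (sym X≡Y+c) X≡m))
  from : Y ≡ m - c → X ≡ m
  from Y≡m-c = trans X≡Y+c (trans (cong (λ i → i ℤ.+ c) Y≡m-c) (uncancel m c))

allianceTest-cong : ∀ {n n′} (Γ : Graph n) (Γ′ : Graph n′) (S : Subset n) (S′ : Subset n′)
                      (v : Fin n) (v′ : Fin n′) k → S v ≡ S′ v′ →
                    deg-in Γ (complement S) v ≡ deg-in Γ′ (complement S′) v′ →
                    deg-in Γ S v ≡ deg-in Γ′ S′ v′ →
                    allianceTest Γ S k v ≡ allianceTest Γ′ S′ k v′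
allianceTest-cong Γ Γ′ S S′ v v′ k in≡ out≡ deg≡ =
  cong₂ (λ b t → not b ∨ t) in≡ (cong₂ (λ d⁻ d⁺ → ⌊ + d⁻ ℤ.+ k ℤ.≤? + d⁺ ⌋) out≡ deg≡)

Counted : ∀ {n} → Graph n → ℤ → Subset n → Bool
Counted {n} Γ m S = nonempty S ∧ connected Γ S ∧ ⌊ + n ℤ.+ exactIndex Γ S ℤ.≟ m ⌋

module _ {n} (Γ : Graph n) {S T : Subset n} (S≗T : S ≗ T) where

  reach-cong : ∀ u k w → reach Γ S u k w ≡ reach Γ T u k w
  reach-cong u zero    w = cong₂ (λ a b → a ∧ b ∧ ⌊ u ≟ᶠ w ⌋) (S≗T u) (S≗T w)
  reach-cong u (suc k) w = cong₂ _∨_ (reach-cong u k w)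
    (cong₂ _∧_ (S≗T w) (anyF-cong (λ v → cong (_∧ adj Γ v w) (reach-cong u k v))))

  exactIndex-cong : exactIndex Γ S ≡ exactIndex Γ T
  exactIndex-cong = begin
    exactIndex Γ S                                         ≡⟨ searchMax≡searchDown Γ S (2 * Δ) (+ Δ) ⟩
    searchDown (isDefAlliance Γ S) (2 * Δ) (+ Δ)           ≡⟨ searchDown-cong alliance-cong (2 * Δ) (+ Δ) ⟩
    searchDown (isDefAlliance Γ T) (2 * Δ) (+ Δ)           ≡⟨ sym (searchMax≡searchDown Γ T (2 * Δ) (+ Δ)) ⟩
    exactIndex Γ T                                         ∎
    where
    open ≡-Reasoning
    Δ = maxDegree Γ
    deg-in-cong : ∀ {X Y : Subset n} → X ≗ Y → ∀ v → deg-in Γ X v ≡ deg-in Γ Y v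
    deg-in-cong X≗Y v = count-cong (λ w → cong (adj Γ v w ∧_) (X≗Y w))
    alliance-cong : isDefAlliance Γ S ≗ isDefAlliance Γ T
    alliance-cong k = allF-cong λ v →
      allianceTest-cong Γ Γ S T v v k (S≗T v) (deg-in-cong (cong not ∘ S≗T) v) (deg-in-cong S≗T v)

  Counted-cong : ∀ m → Counted Γ m S ≡ Counted Γ m T
  Counted-cong m = cong₂ _∧_ (anyF-cong S≗T) (cong₂ _∧_ connected-cong index-cong)
    where
    connected-cong : connected Γ S ≡ connected Γ T
    connected-cong = allF-cong λ u → allF-cong λ w →
      cong₂ _∨_ (cong₂ (λ a b → not (a ∧ b)) (S≗T u) (S≗T w)) (reach-cong u n w)
    index-cong : ⌊ + n ℤ.+ exactIndex Γ S ℤ.≟ m ⌋ ≡ ⌊ + n ℤ.+ exactIndex Γ T ℤ.≟ m ⌋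
    index-cong = cong (λ k → ⌊ + n ℤ.+ k ℤ.≟ m ⌋) exactIndex-cong

allianceCoeff-as-sum : ∀ {n} (Γ : Graph n) m → allianceCoeff Γ m ≡ Σˢ n (ind ∘ Counted Γ m)
allianceCoeff-as-sum {n} Γ m = filter-allSubsets n (Counted Γ m) (λ S≗T → Counted-cong Γ S≗T m)

connectedTest : ∀ {n} → Graph n → Subset n → Fin n → Fin n → Bool
connectedTest {n} Γ S u w = not (S u ∧ S w) ∨ reach Γ S u n w

-- A decomposition of G into parts H₁ and H₂ with no edges between them: ι₁ and
-- ι₂ embed H₁ and H₂ as induced subgraphs, their images partition the vertices
-- (so every iterated operation over the vertices of G splits along them), and
-- no vertex of the first part is adjacent to a vertex of the second.
record Decomposition {N c₁ c₂ : ℕ} (G : Graph N) (H₁ : Graph c₁) (H₂ : Graph c₂) : Set₁ where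
  field
    ι₁           : Fin c₁ → Fin N
    ι₂           : Fin c₂ → Fin N
    ι₁-injective : ∀ {x y} → ι₁ x ≡ ι₁ y → x ≡ y
    ι₂-injective : ∀ {x y} → ι₂ x ≡ ι₂ y → x ≡ y
    ι₁≢ι₂        : ∀ x y → ι₁ x ≢ ι₂ y
    adj-ι₁       : ∀ x y → adj G (ι₁ x) (ι₁ y) ≡ adj H₁ x y
    adj-ι₂       : ∀ x y → adj G (ι₂ x) (ι₂ y) ≡ adj H₂ x y
    adj-ι₁ι₂     : ∀ x y → adj G (ι₁ x) (ι₂ y) ≡ false
    ⨁-split      : ∀ {A : Set} {_⊙_ : A → A → A} {ε : A} → IsCommutativeMonoid _≡_ _⊙_ ε →
                   ∀ f → ⨁ _⊙_ ε f ≡ ⨁ _⊙_ ε (f ∘ ι₁) ⊙ ⨁ _⊙_ ε (f ∘ ι₂)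

-- The roles of the two parts can be exchanged, so facts about the first part
-- also hold for the second.
swap : ∀ {N c₁ c₂} {G : Graph N} {H₁ : Graph c₁} {H₂ : Graph c₂} →
       Decomposition G H₁ H₂ → Decomposition G H₂ H₁
swap {G = G} D = record
  { ι₁ = ι₂ ; ι₂ = ι₁ ; ι₁-injective = ι₂-injective ; ι₂-injective = ι₁-injective
  ; ι₁≢ι₂ = λ y x → ι₁≢ι₂ x y ∘ sym
  ; adj-ι₁ = adj-ι₂ ; adj-ι₂ = adj-ι₁
  ; adj-ι₁ι₂ = λ y x → trans (Graph.sym G (ι₂ y) (ι₁ x)) (adj-ι₁ι₂ x y)
  ; ⨁-split = λ M f → trans (⨁-split M f) (IsCommutativeMonoid.comm M _ _) }
  where open Decomposition D

module FirstPart {N c₁ c₂} {G : Graph N} {H₁ : Graph c₁} {H₂ : Graph c₂}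
                 (D : Decomposition G H₁ H₂) where
  open Decomposition D

  order : N ≡ c₁ + c₂
  order = begin
    N                                                   ≡⟨ sym (ones N) ⟩
    ⨁ _+_ 0 (λ (_ : Fin N) → 1)                         ≡⟨ ⨁-split +-0-isCommutativeMonoid _ ⟩
    ⨁ _+_ 0 (λ (_ : Fin c₁) → 1) + ⨁ _+_ 0 (λ (_ : Fin c₂) → 1) ≡⟨ cong₂ _+_ (ones c₁) (ones c₂) ⟩
    c₁ + c₂                                             ∎
    where
    open ≡-Reasoning
    ones : ∀ n → ⨁ _+_ 0 (λ (_ : Fin n) → 1) ≡ n
    ones zero    = refl
    ones (suc n) = cong suc (ones n)

  ⨁-first : ∀ {A : Set} {_⊙_ : A → A → A} {ε : A} → IsCommutativeMonoid _≡_ _⊙_ ε →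
            ∀ f → (∀ y → f (ι₂ y) ≡ ε) → ⨁ _⊙_ ε f ≡ ⨁ _⊙_ ε (f ∘ ι₁)
  ⨁-first {_⊙_ = _⊙_} M f neutral = trans (⨁-split M f)
    (trans (cong (_ ⊙_) (⨁-Laws.⨁-ε isMonoid (f ∘ ι₂) neutral)) (identityʳ _))
    where open IsCommutativeMonoid M using (isMonoid; identityʳ)

  anyF-first : ∀ p → (∀ y → p (ι₂ y) ≡ false) → anyF p ≡ anyF (p ∘ ι₁)
  anyF-first p neutral = trans (anyF≡anyᶠ p)
    (trans (⨁-first ∨-isCommutativeMonoid p neutral) (sym (anyF≡anyᶠ (p ∘ ι₁))))

  allF-first : ∀ p → (∀ y → p (ι₂ y) ≡ true) → allF p ≡ allF (p ∘ ι₁)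
  allF-first p neutral = trans (allF≡allᶠ p)
    (trans (⨁-first ∧-isCommutativeMonoid p neutral) (sym (allF≡allᶠ (p ∘ ι₁))))

  count-first : ∀ p → (∀ y → p (ι₂ y) ≡ false) → count p ≡ count (p ∘ ι₁)
  count-first p neutral = trans (count≡countᶠ p)
    (trans (⨁-first +-0-isCommutativeMonoid (ind ∘ p) (cong ind ∘ neutral)) (sym (count≡countᶠ (p ∘ ι₁))))

  deg-in-first : ∀ (X : Subset N) (X′ : Subset c₁) → (∀ y → X (ι₁ y) ≡ X′ y) →
                 ∀ x → deg-in G X (ι₁ x) ≡ deg-in H₁ X′ x
  deg-in-first X X′ X∘ι₁ x =
    trans (count-first _ (λ y → cong (_∧ X (ι₂ y)) (adj-ι₁ι₂ x y)))
          (count-cong (λ y → cong₂ _∧_ (adj-ι₁ x y) (X∘ι₁ y)))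

  maxDegree-first : maxDegree H₁ ≤ maxDegree G
  maxDegree-first = begin
    maxDegree H₁     ≡⟨ maxDegree≡maxᶠ H₁ ⟩
    maxᶠ (degree H₁) ≤⟨ maxᶠ-least (degree H₁) (λ x → ≤-trans (≤-reflexive (sym (degree-first x)))
                                                              (maxᶠ-upper (degree G) (ι₁ x))) ⟩
    maxᶠ (degree G)  ≡⟨ sym (maxDegree≡maxᶠ G) ⟩
    maxDegree G      ∎
    where
    open ≤-Reasoning
    degree-first : ∀ x → degree G (ι₁ x) ≡ degree H₁ x
    degree-first x = trans (count-first _ (adj-ι₁ι₂ x)) (count-cong (adj-ι₁ x))

  reach-crossing : ∀ S x k y → reach G S (ι₁ x) k (ι₂ y) ≡ false
  reach-crossing S x zero y = begin
    S (ι₁ x) ∧ S (ι₂ y) ∧ ⌊ ι₁ x ≟ᶠ ι₂ y ⌋ ≡⟨ cong (λ b → S (ι₁ x) ∧ S (ι₂ y) ∧ b)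
                                                  (⌊⌋-false (ι₁ x ≟ᶠ ι₂ y) (ι₁≢ι₂ x y)) ⟩
    S (ι₁ x) ∧ S (ι₂ y) ∧ false          ≡⟨ cong (S (ι₁ x) ∧_) (∧-zeroʳ _) ⟩
    S (ι₁ x) ∧ false                     ≡⟨ ∧-zeroʳ _ ⟩
    false                                ∎
    where open ≡-Reasoning
  reach-crossing S x (suc k) y =
    trans (cong₂ (λ a b → a ∨ (S (ι₂ y) ∧ b)) (reach-crossing S x k y) no-last-step) (∧-zeroʳ _)
    where
    no-last-step : anyF (λ v → reach G S (ι₁ x) k v ∧ adj G v (ι₂ y)) ≡ false
    no-last-step = trans (anyF-first _ (λ y′ → cong (_∧ _) (reach-crossing S x k y′)))
                         (anyF-false _ (λ x′ → trans (cong (reach G S (ι₁ x) k (ι₁ x′) ∧_)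
                                                           (adj-ι₁ι₂ x′ y))
                                                     (∧-zeroʳ _)))

  crossing-disconnected : ∀ S x y → S (ι₁ x) ≡ true → S (ι₂ y) ≡ true → connected G S ≡ false
  crossing-disconnected S x y x∈S y∈S =
    trans (allF≡allᶠ (λ u → allF (connectedTest G S u))) (allᶠ-false _ (ι₁ x)
      (trans (allF≡allᶠ (connectedTest G S (ι₁ x))) (allᶠ-false (connectedTest G S (ι₁ x)) (ι₂ y)
        (trans (cong₂ (λ a b → not (a ∧ b) ∨ reach G S (ι₁ x) N (ι₂ y)) x∈S y∈S)
               (reach-crossing S x N y)))))

  module _ (S : Subset N) (A : Subset c₁)
           (S∘ι₁ : ∀ x → S (ι₁ x) ≡ A x) (S∘ι₂ : ∀ y → S (ι₂ y) ≡ false) where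

    alliance-first : ∀ k → isDefAlliance G S k ≡ isDefAlliance H₁ A k
    alliance-first k = trans (allF-first (allianceTest G S k) outside) (allF-cong same-test)
      where
      test : ∀ y → Bool
      test y = ⌊ + deg-in G (complement S) (ι₂ y) ℤ.+ k ℤ.≤? + deg-in G S (ι₂ y) ⌋
      outside : ∀ y → allianceTest G S k (ι₂ y) ≡ true
      outside y = cong (λ b → not b ∨ test y) (S∘ι₂ y)
      same-test : ∀ x → allianceTest G S k (ι₁ x) ≡ allianceTest H₁ A k x
      same-test x = allianceTest-cong G H₁ S A (ι₁ x) x k (S∘ι₁ x)
        (deg-in-first (complement S) (complement A) (cong not ∘ S∘ι₁) x) (deg-in-first S A S∘ι₁ x)

    exactIndex-first : anyF A ≡ true → exactIndex G S ≡ exactIndex H₁ A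
    exactIndex-first nonempty =
      trans (searchMax≡searchDown G S (2 * maxDegree G) (+ maxDegree G))
            (AllianceRange.exactIndex-search H₁ A nonempty _ alliance-first (maxDegree G) maxDegree-first)

    reach-first : ∀ x k z → reach G S (ι₁ x) k (ι₁ z) ≡ reach H₁ A x k z
    reach-first x zero z =
      cong₂ _∧_ (S∘ι₁ x)
        (cong₂ _∧_ (S∘ι₁ z) (⌊⌋-⇔ ι₁-injective (cong ι₁) (ι₁ x ≟ᶠ ι₁ z) (x ≟ᶠ z)))
    reach-first x (suc k) z = cong₂ _∨_ (reach-first x k z) (cong₂ _∧_ (S∘ι₁ z) last-step)
      where
      last-step : anyF (λ v → reach G S (ι₁ x) k v ∧ adj G v (ι₁ z))
                ≡ anyF (λ v → reach H₁ A x k v ∧ adj H₁ v z)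
      last-step = trans (anyF-first _ (λ y → cong (_∧ adj G (ι₂ y) (ι₁ z)) (reach-crossing S x k y)))
                        (anyF-cong (λ v → cong₂ _∧_ (reach-first x k v) (adj-ι₁ v z)))

    connected-first : connected G S ≡ connected H₁ A
    connected-first = trans (allF-first _ outside) (allF-cong same-row)
      where
      outside : ∀ y → allF (connectedTest G S (ι₂ y)) ≡ true
      outside y = allF-true _ (λ w → cong (λ b → not (b ∧ S w) ∨ reach G S (ι₂ y) N w) (S∘ι₂ y))
      long-walks : ∀ x z → reach G S (ι₁ x) N (ι₁ z) ≡ reach H₁ A x c₁ z
      long-walks x z = begin
        reach G S (ι₁ x) N (ι₁ z)  ≡⟨ reach-first x N z ⟩
        reach H₁ A x N z           ≡⟨ cong (λ k → reach H₁ A x k z) (trans order (+-comm c₁ c₂)) ⟩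
        reach H₁ A x (c₂ + c₁) z   ≡⟨ reach-stabilises H₁ A x c₂ z ⟩
        reach H₁ A x c₁ z          ∎
        where open ≡-Reasoning
      same-row : ∀ x → allF (connectedTest G S (ι₁ x)) ≡ allF (connectedTest H₁ A x)
      same-row x = trans
        (allF-first _ (λ y → cong (λ b → not b ∨ reach G S (ι₁ x) N (ι₂ y))
                                  (trans (cong (S (ι₁ x) ∧_) (S∘ι₂ y)) (∧-zeroʳ _))))
        (allF-cong (λ z → cong₂ _∨_ (cong₂ (λ a b → not (a ∧ b)) (S∘ι₁ x) (S∘ι₁ z))
                                    (long-walks x z)))

    counted-first : ∀ m → Counted G m S ≡ Counted H₁ (m - + c₂) A
    counted-first m = ∧-congʳ-when (trans (anyF-first S S∘ι₂) (anyF-cong S∘ι₁)) λ nonempty →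
      cong₂ _∧_ connected-first
        (trans (cong (λ k → ⌊ + N ℤ.+ k ℤ.≟ m ⌋) (exactIndex-first nonempty))
               (⌊⌋-shift m (trans (cong (λ n → + n ℤ.+ exactIndex H₁ A) order)
                                  (regroup (+ c₁) (+ c₂) (exactIndex H₁ A)))))
      where
      regroup : ∀ (i j k : ℤ) → (i ℤ.+ j) ℤ.+ k ≡ (i ℤ.+ k) ℤ.+ j
      regroup = ℤ-Solver.solve-∀

⊕-decomposition : ∀ {a b} (Γ₁ : Graph a) (Γ₂ : Graph b) → Decomposition (Γ₁ ⊕ Γ₂) Γ₁ Γ₂
⊕-decomposition {a} {b} Γ₁ Γ₂ = record
  { ι₁ = _↑ˡ b ; ι₂ = a ↑ʳ_
  ; ι₁-injective = ↑ˡ-injective b _ _ ; ι₂-injective = ↑ʳ-injective a _ _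
  ; ι₁≢ι₂ = λ x y eq → inj₁≢inj₂
      (trans (sym (splitAt-↑ˡ a x b)) (trans (cong (splitAt a) eq) (splitAt-↑ʳ a b y)))
  ; adj-ι₁ = adj-ι₁ ; adj-ι₂ = adj-ι₂ ; adj-ι₁ι₂ = adj-ι₁ι₂
  ; ⨁-split = λ M → ⨁-Laws.⨁-↑ (IsCommutativeMonoid.isMonoid M) a }
  where
  inj₁≢inj₂ : ∀ {x : Fin a} {y : Fin b} → inj₁ x ≢ inj₂ y
  inj₁≢inj₂ ()
  adj-ι₁ : ∀ x y → adjU Γ₁ Γ₂ (x ↑ˡ b) (y ↑ˡ b) ≡ adj Γ₁ x y
  adj-ι₁ x y rewrite splitAt-↑ˡ a x b | splitAt-↑ˡ a y b = refl
  adj-ι₂ : ∀ x y → adjU Γ₁ Γ₂ (a ↑ʳ x) (a ↑ʳ y) ≡ adj Γ₂ x y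
  adj-ι₂ x y rewrite splitAt-↑ʳ a b x | splitAt-↑ʳ a b y = refl
  adj-ι₁ι₂ : ∀ x y → adjU Γ₁ Γ₂ (x ↑ˡ b) (a ↑ʳ y) ≡ false
  adj-ι₁ι₂ x y rewrite splitAt-↑ˡ a x b | splitAt-↑ʳ a b y = refl

uncounted : ∀ {n} (Γ : Graph n) m (S : Subset n) → anyᶠ S ≡ false → ind (Counted Γ m S) ≡ 0
uncounted {n} Γ m S empty =
  cong (λ b → ind (b ∧ connected Γ S ∧ ⌊ + n ℤ.+ exactIndex Γ S ℤ.≟ m ⌋)) (trans (anyF≡anyᶠ S) empty)

module BinaryUnion {a b} (Γ₁ : Graph a) (Γ₂ : Graph b) where
  G = Γ₁ ⊕ Γ₂
  D = ⊕-decomposition Γ₁ Γ₂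

  module _ (m : ℤ) (A : Subset a) (B : Subset b) where
    S = joinˢ A B

    in-Γ₁ : anyᶠ B ≡ false → ind (Counted G m S) ≡ ind (Counted Γ₁ (m - + b) A)
    in-Γ₁ B≡∅ = cong ind (FirstPart.counted-first D S A (joinˢ-↑ˡ A B)
                           (λ y → trans (joinˢ-↑ʳ A B y) (anyᶠ-false B B≡∅ y)) m)

    in-Γ₂ : anyᶠ A ≡ false → ind (Counted G m S) ≡ ind (Counted Γ₂ (m - + a) B)
    in-Γ₂ A≡∅ = cong ind (FirstPart.counted-first (swap D) S B (joinˢ-↑ʳ A B)
                           (λ x → trans (joinˢ-↑ˡ A B x) (anyᶠ-false A A≡∅ x)) m)

    in-both : ∀ x y → A x ≡ true → B y ≡ true → ind (Counted G m S) ≡ 0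
    in-both x y x∈A y∈B = cong ind (trans
      (cong (λ c → nonempty S ∧ c ∧ ⌊ + (a + b) ℤ.+ exactIndex G S ℤ.≟ m ⌋)
            (FirstPart.crossing-disconnected D S x y (trans (joinˢ-↑ˡ A B x) x∈A)
                                                     (trans (joinˢ-↑ʳ A B y) y∈B)))
      (∧-zeroʳ _))

    counted-split : ind (Counted G m S) ≡ (if anyᶠ B then 0 else ind (Counted Γ₁ (m - + b) A))
                                        + (if anyᶠ A then 0 else ind (Counted Γ₂ (m - + a) B))
    counted-split with anyᶠ A in any-A | anyᶠ B in any-B
    ... | true  | false = trans (in-Γ₁ any-B) (sym (+-identityʳ _))
    ... | false | false =
      trans (in-Γ₁ any-B) (sym (trans (cong (_+_ _) (uncounted Γ₂ _ B any-B)) (+-identityʳ _)))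
    ... | false | true  = in-Γ₂ any-A
    ... | true  | true  with anyᶠ-witness A any-A | anyᶠ-witness B any-B
    ...   | x , x∈A | y , y∈B = in-both x y x∈A y∈B

  coefficient-⊕ : ∀ m → allianceCoeff G m ≡ allianceCoeff Γ₁ (m - + b) + allianceCoeff Γ₂ (m - + a)
  coefficient-⊕ m = begin
    allianceCoeff G m
      ≡⟨ allianceCoeff-as-sum G m ⟩
    Σˢ (a + b) (ind ∘ Counted G m)
      ≡⟨ Σˢ-join a (ind ∘ Counted G m) (λ S≗T → cong ind (Counted-cong G S≗T m)) ⟩
    Σˢ a (λ A → Σˢ b (λ B → ind (Counted G m (joinˢ A B))))
      ≡⟨ Σˢ-cong a (λ A → Σˢ-cong b (counted-split m A)) ⟩
    Σˢ a (λ A → Σˢ b (λ B → (if anyᶠ B then 0 else c₁ A) + (if anyᶠ A then 0 else c₂ B)))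
      ≡⟨ Σˢ-cong a (λ A → trans (Σˢ-+ b _ _)
                              (cong₂ _+_ (Σˢ-empty b (c₁ A)) (Σˢ-if b (anyᶠ A) c₂))) ⟩
    Σˢ a (λ A → c₁ A + (if anyᶠ A then 0 else Σˢ b c₂))
      ≡⟨ Σˢ-+ a c₁ _ ⟩
    Σˢ a c₁ + Σˢ a (λ A → if anyᶠ A then 0 else Σˢ b c₂)
      ≡⟨ cong₂ _+_ (sym (allianceCoeff-as-sum Γ₁ (m - + b)))
                   (trans (Σˢ-empty a _) (sym (allianceCoeff-as-sum Γ₂ (m - + a)))) ⟩
    allianceCoeff Γ₁ (m - + b) + allianceCoeff Γ₂ (m - + a)
      ∎
    where
    open ≡-Reasoning
    c₁ = ind ∘ Counted Γ₁ (m - + b)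
    c₂ = ind ∘ Counted Γ₂ (m - + a)

sumF-cong : ∀ r {f g : Fin r → ℕ} → f ≗ g → sumF r f ≡ sumF r g
sumF-cong zero    f≗g = refl
sumF-cong (suc r) f≗g = cong₂ _+_ (f≗g zero) (sumF-cong r (f≗g ∘ suc))

-- The general statement, by induction on the number r of graphs: the empty
-- union has no counted sets, and Γ₀ ∪ ⋯ ∪ Γ_r is Γ₀ ⊕ (Γ₁ ∪ ⋯ ∪ Γ_r).
union-coefficient : (r : ℕ) (ns : Fin r → ℕ) (Γs : (i : Fin r) → Graph (ns i)) (m : ℤ) →
  allianceCoeff (unionF r ns Γs) m ≡ sumF r (λ i → allianceCoeff (Γs i) (m - (+ sumF r ns - + ns i)))
union-coefficient zero    ns Γs m = refl
union-coefficient (suc r) ns Γs m = begin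
  allianceCoeff (Γs zero ⊕ unionF r ns′ Γs′) m
    ≡⟨ BinaryUnion.coefficient-⊕ (Γs zero) (unionF r ns′ Γs′) m ⟩
  allianceCoeff (Γs zero) (m - + n′) + allianceCoeff (unionF r ns′ Γs′) (m - + n₀)
    ≡⟨ cong₂ _+_ (cong (allianceCoeff (Γs zero)) (first-exponent m (+ n₀) (+ n′)))
                 (union-coefficient r ns′ Γs′ (m - + n₀)) ⟩
  allianceCoeff (Γs zero) (m - (+ (n₀ + n′) - + n₀))
    + sumF r (λ i → allianceCoeff (Γs′ i) (m - + n₀ - (+ n′ - + ns′ i)))
    ≡⟨ cong (_+_ _) (sumF-cong r (λ i → cong (allianceCoeff (Γs′ i))
                                     (later-exponent m (+ n₀) (+ n′) (+ ns′ i)))) ⟩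
  sumF (suc r) (λ i → allianceCoeff (Γs i) (m - (+ sumF (suc r) ns - + ns i)))
    ∎
  where
  open ≡-Reasoning
  ns′ = ns ∘ suc
  Γs′ = λ i → Γs (suc i)
  n₀ = ns zero
  n′ = sumF r ns′
  first-exponent : ∀ (m x y : ℤ) → m - y ≡ m - ((x ℤ.+ y) - x)
  first-exponent = ℤ-Solver.solve-∀
  later-exponent : ∀ (m x y z : ℤ) → m - x - (y - z) ≡ m - ((x ℤ.+ y) - z)
  later-exponent = ℤ-Solver.solve-∀

-- Theorem 2.8.
theorem2p8 : (r : ℕ) → 2 ≤ r → (ns : Fin r → ℕ) → (∀ i → 1 ≤ ns i) →
    (Γs : (i : Fin r) → Graph (ns i)) → (m : ℤ) →
    allianceCoeff (unionF r ns Γs) m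
      ≡ sumF r (λ i → allianceCoeff (Γs i) (m - (+ sumF r ns - + ns i)))
theorem2p8 r _ ns _ Γs m = union-coefficient r ns Γs m
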